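{- Let $C'$ be a sequence (column) of $c'$ distinct positive integers and $S=\{a_1>a_2>\dots>a_c\}$ a set of positive integers with $c\in\{c',c'+1\}$, such that, writing $s_1<\dots<s_c$ for the elements of $S$ and $e_1<\dots<e_{c'}$ for the entries of $C'$ in increasing order, $s_r\le e_r$ for all $r\le c'$. Let $\widehat{C}=\widehat{C}(S,C')$ be the hat column (see context). Then the two-column configuration $\widehat{C}C'$ is HHL.
   Context: Hat construction: $\widehat{C}$ is the column of length $c$ obtained by processing the elements of $S$ in decreasing order: an element $a$ occurring in $C'$ is placed in the row in which $a$ occurs in $C'$; an element $a$ not occurring in $C'$ is placed, if $c=c'+1$ and row $c'+1$ is still empty, in row $c'+1$, and otherwise in the row of the largest entry of $C'$ whose row in the left column is still empty. A two-column configuration $CC'$ (left column $C$ of length $c$, right column $C'$ of length $c'$, top-aligned, $c\in\{c',c'+1\}$) is HHL if the entries of each column are distinct, $C(r)\le C'(r)$ for all $r\le c'$, and $C(r)\neq C'(s)$ whenever $s<r$ (no equal entries in attacking cells, where a left-column cell attacks a right-column cell lying strictly above it). -}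

module Defs where

open import Data.Nat using (ℕ; zero; suc; _≤_; _<_; _≟_; _<ᵇ_)
open import Data.Nat.Properties using (≤-decTotalOrder)
open import Data.Bool using (Bool; true; false; if_then_else_)
open import Data.Maybe using (Maybe; just; nothing; _>>=_)
open import Data.List using (List; []; _∷_; length; replicate; reverse)
open import Data.List.Relation.Unary.All using (All)
open import Data.List.Relation.Unary.AllPairs using (AllPairs)
open import Data.List.Relation.Unary.Unique.Propositional using (Unique)
open import Data.Product using (_×_)
open import Data.Sum using (_⊎_)
open import Relation.Binary.PropositionalEquality using (_≡_; _≢_)
open import Relation.Nullary using (yes; no)
import Data.List.Sort

open Data.List.Sort ≤-decTotalOrder public using (sort)

-- Columns are lists, row r (1-based in the paper) is index r-1 here.
-- Partial indexing.
nth : {A : Set} → List A → ℕ → Maybe A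
nth []       _       = nothing
nth (x ∷ xs) zero    = just x
nth (x ∷ xs) (suc n) = nth xs n

indexOf : ℕ → List ℕ → Maybe ℕ
indexOf a []       = nothing
indexOf a (x ∷ xs) with a ≟ x
... | yes _ = just zero
... | no  _ with indexOf a xs
...   | just i  = just (suc i)
...   | nothing = nothing

isEmptyRow : List (Maybe ℕ) → ℕ → Bool
isEmptyRow L r with nth L r
... | just nothing = true
... | _            = false

place : ℕ → ℕ → List (Maybe ℕ) → Maybe (List (Maybe ℕ))
place a r       []             = nothing
place a zero    (nothing ∷ L)  = just (just a ∷ L)
place a zero    (just _ ∷ L)   = nothing
place a (suc r) (m ∷ L)        with place a r L
... | just L' = just (m ∷ L')
... | nothing = nothing

-- Row of the largest entry of C' whose row in the left column is still
-- empty.  Scans C' (rows i, i+1, ...) keeping the best (value, row) found.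
largestEmptyRowFrom : List ℕ → List (Maybe ℕ) → ℕ → Maybe (ℕ × ℕ) → Maybe ℕ
largestEmptyRowFrom []        L i best = Data.Maybe.map Data.Product.proj₂ best
  where import Data.Product
largestEmptyRowFrom (e ∷ C')  L i best =
  largestEmptyRowFrom C' L (suc i) (upd (isEmptyRow L i) best)
  where
  open import Data.Product using (_,_)
  upd : Bool → Maybe (ℕ × ℕ) → Maybe (ℕ × ℕ)
  upd false b              = b
  upd true  nothing        = just (e , i)
  upd true  (just (v , j)) = if v <ᵇ e then just (e , i) else just (v , j)

largestEmptyRow : List ℕ → List (Maybe ℕ) → Maybe ℕ
largestEmptyRow C' L = largestEmptyRowFrom C' L zero nothing

-- One step of the hat construction, processing element a.
-- c = length of the hat column, C' = right column (c' = length C').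
hatStep : ℕ → List ℕ → List (Maybe ℕ) → ℕ → Maybe (List (Maybe ℕ))
hatStep c C' L a with indexOf a C'
... | just r  = place a r L
... | nothing with c ≟ suc (length C') | isEmptyRow L (length C')
...   | yes _ | true  = place a (length C') L
...   | _     | _     = largestEmptyRow C' L >>= λ r → place a r L

hatSteps : ℕ → List ℕ → Maybe (List (Maybe ℕ)) → List ℕ → Maybe (List (Maybe ℕ))
hatSteps c C' ml []       = ml
hatSteps c C' ml (a ∷ as) = hatSteps c C' (ml >>= λ L → hatStep c C' L a) as

complete : List (Maybe ℕ) → Maybe (List ℕ)
complete []             = just []
complete (nothing ∷ L)  = nothing
complete (just x ∷ L)   = Data.Maybe.map (x ∷_) (complete L)

-- The hat column Ĉ(S, C'), where S is given as the list a₁ > a₂ > ... > a_c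
-- (so the elements are processed in decreasing order, i.e. list order).
-- Returns nothing if the construction is ill-defined.
hat : List ℕ → List ℕ → Maybe (List ℕ)
hat S C' = hatSteps c C' (just (replicate c nothing)) S >>= complete
  where c = length S

StrictlyDecreasing : List ℕ → Set
StrictlyDecreasing = AllPairs (λ x y → y < x)

record HHL (C C' : List ℕ) : Set where
  field
    lengths   : length C ≡ length C' ⊎ length C ≡ suc (length C')
    distinctL : Unique C
    distinctR : Unique C'
    rowsLeq   : ∀ r x y → r < length C' → nth C r ≡ just x → nth C' r ≡ just y → x ≤ y
    noAttack  : ∀ r s x y → s < r → nth C r ≡ just x → nth C' s ≡ just y → x ≢ y

-- S is processed in decreasing order, and every partial hat column satisfies an invariant:
-- each placed entry exceeds all elements still to be placed, and an entry z in row i either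
-- equals C'(i), or does not occur in C' and is smaller than C'(i).  An element of C' therefore
-- finds its own row empty.  For any other element a, the hypothesis s_r ≤ e_r leaves more
-- entries ≥ a in C' than rows filled among the first c' rows, so some such row is empty and the
-- largest empty row has an entry > a.  At the end the invariant is the HHL condition.
module Submission where

open import Defs
open import Data.Bool using (true; false; T)
open import Data.Empty using (⊥-elim)
open import Data.List using (List; []; _∷_; length; reverse; replicate; filter; take; _++_; [_])
open import Data.List.Properties
  using (unfold-reverse; length-reverse; length-replicate; filter-all; filter-accept; filter-reject; take-all)
open import Data.List.Relation.Binary.Permutation.Propositional using (_↭_)
open import Data.List.Relation.Binary.Permutation.Propositional.Properties using (↭-length; filter-↭)
open import Data.List.Relation.Unary.All using (All; []; _∷_)
open import Data.List.Relation.Unary.AllPairs using ([]; _∷_)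
open import Data.List.Relation.Unary.Linked using (Linked; tail)
open import Data.List.Relation.Unary.Linked.Properties using (Linked⇒All)
open import Data.List.Relation.Unary.Unique.Propositional using (Unique)
open import Data.Maybe using (Maybe; just; nothing; _>>=_)
open import Data.Maybe.Properties using (just-injective)
open import Data.Nat using (ℕ; zero; suc; _+_; _≤_; _<_; _<ᵇ_; z≤n; s≤s; s≤s⁻¹)
open import Data.Nat.Properties
open import Data.Product using (Σ; _×_; _,_; ∃; ∃₂)
open import Data.Sum using (_⊎_; inj₁; inj₂; [_,_]′)
open import Data.Unit using (⊤; tt)
open import Function using (_∘_; id)
open import Relation.Nullary using (¬_; yes; no; contradiction)
open import Relation.Binary.PropositionalEquality
  using (_≡_; _≢_; refl; sym; trans; cong; subst; subst₂)
import Data.List.Sort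
open Data.List.Sort ≤-decTotalOrder using (sort-↭; sort-↗)

private
  variable
    A : Set

nth-<-length : ∀ (xs : List A) i {x} → nth xs i ≡ just x → i < length xs
nth-<-length (_ ∷ _)  zero    _  = s≤s z≤n
nth-<-length (_ ∷ xs) (suc i) eq = s≤s (nth-<-length xs i eq)

<-length⇒nth : ∀ (xs : List A) i → i < length xs → ∃ λ x → nth xs i ≡ just x
<-length⇒nth (x ∷ _)  zero    _        = x , refl
<-length⇒nth (_ ∷ xs) (suc i) (s≤s lt) = <-length⇒nth xs i lt

nth-length : ∀ (xs : List A) → nth xs (length xs) ≡ nothing
nth-length []       = refl
nth-length (_ ∷ xs) = nth-length xs

nth-++ˡ : ∀ (xs ys : List A) i {x} → nth xs i ≡ just x → nth (xs ++ ys) i ≡ just x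
nth-++ˡ (_ ∷ _)  ys zero    eq = eq
nth-++ˡ (_ ∷ xs) ys (suc i) eq = nth-++ˡ xs ys i eq

nth-∷ʳ-length : ∀ (xs : List A) y → nth (xs ++ [ y ]) (length xs) ≡ just y
nth-∷ʳ-length []       y = refl
nth-∷ʳ-length (_ ∷ xs) y = nth-∷ʳ-length xs y

nth-reverse-∷ˡ : ∀ (x : A) xs i {y} →
  nth (reverse xs) i ≡ just y → nth (reverse (x ∷ xs)) i ≡ just y
nth-reverse-∷ˡ x xs i eq rewrite unfold-reverse x xs = nth-++ˡ (reverse xs) [ x ] i eq

nth-reverse-∷-length : ∀ (x : A) xs → nth (reverse (x ∷ xs)) (length xs) ≡ just x
nth-reverse-∷-length x xs rewrite unfold-reverse x xs =
  subst (λ k → nth (reverse xs ++ [ x ]) k ≡ just x) (length-reverse xs) (nth-∷ʳ-length (reverse xs) x)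

NthInjective : List A → Set _
NthInjective xs = ∀ {i j x} → nth xs i ≡ just x → nth xs j ≡ just x → i ≡ j

All≢⇒nth≢ : ∀ {x : A} {ys} → All (x ≢_) ys → ∀ j → nth ys j ≢ just x
All≢⇒nth≢ (x≢y ∷ _)  zero    e = x≢y (just-injective (sym e))
All≢⇒nth≢ (_ ∷ x≢ys) (suc j) e = All≢⇒nth≢ x≢ys j e

Unique⇒nth-injective : ∀ {xs : List A} → Unique xs → NthInjective xs
Unique⇒nth-injective _        {zero}  {zero}  _    _    = refl
Unique⇒nth-injective (x∉ ∷ _) {zero}  {suc j} refl e₂   = ⊥-elim (All≢⇒nth≢ x∉ j e₂)
Unique⇒nth-injective (x∉ ∷ _) {suc i} {zero}  e₁   refl = ⊥-elim (All≢⇒nth≢ x∉ i e₁)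
Unique⇒nth-injective (_ ∷ u)  {suc i} {suc j} e₁   e₂   = cong suc (Unique⇒nth-injective u e₁ e₂)

nth≢⇒All≢ : ∀ {x : A} ys → (∀ j → nth ys j ≢ just x) → All (x ≢_) ys
nth≢⇒All≢ []       _      = []
nth≢⇒All≢ (_ ∷ ys) x∉ys = (λ { refl → x∉ys zero refl }) ∷ nth≢⇒All≢ ys (λ j → x∉ys (suc j))

nth-injective⇒Unique : ∀ {xs : List A} → NthInjective xs → Unique xs
nth-injective⇒Unique {xs = []}     _   = []
nth-injective⇒Unique {xs = _ ∷ xs} inj =
  nth≢⇒All≢ xs (λ j e → 0≢1+n (inj refl e))
    ∷ nth-injective⇒Unique (λ e₁ e₂ → suc-injective (inj e₁ e₂))

indexOf-just : ∀ a xs {r} → indexOf a xs ≡ just r → nth xs r ≡ just a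
indexOf-just a (x ∷ xs) eq with a ≟ x
indexOf-just a (x ∷ xs) refl | yes refl = refl
... | no _ with indexOf a xs in eq′
indexOf-just a (x ∷ xs) refl | no _ | just i = indexOf-just a xs eq′

indexOf-nothing : ∀ a xs i → indexOf a xs ≡ nothing → nth xs i ≢ just a
indexOf-nothing a (x ∷ xs) i eq e with a ≟ x
... | no a≢x with indexOf a xs in eq′
indexOf-nothing a (x ∷ xs) zero    refl e | no a≢x | nothing = a≢x (sym (just-injective e))
indexOf-nothing a (x ∷ xs) (suc i) refl e | no a≢x | nothing = indexOf-nothing a xs i eq′ e

countGe : ℕ → List ℕ → ℕ
countGe a xs = length (filter (a ≤?_) xs)

countGe-↭ : ∀ a {xs ys} → xs ↭ ys → countGe a xs ≡ countGe a ys
countGe-↭ a p = ↭-length (filter-↭ (a ≤?_) p)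

countGe-accept : ∀ {a x} xs → a ≤ x → countGe a (x ∷ xs) ≡ suc (countGe a xs)
countGe-accept {a} _ a≤x = cong length (filter-accept (a ≤?_) a≤x)

countGe-reject : ∀ {a x} xs → ¬ a ≤ x → countGe a (x ∷ xs) ≡ countGe a xs
countGe-reject {a} _ a≰x = cong length (filter-reject (a ≤?_) a≰x)

countGe-∷ : ∀ a x xs → countGe a xs ≤ countGe a (x ∷ xs)
countGe-∷ a x xs with a ≤? x
... | yes a≤x = ≤-trans (n≤1+n _) (≤-reflexive (sym (countGe-accept xs a≤x)))
... | no  a≰x = ≤-reflexive (sym (countGe-reject xs a≰x))

countGe-sorted : ∀ a {xs} q {e} → Linked _≤_ xs → nth xs q ≡ just e → a ≤ e →
  length xs ≤ countGe a xs + q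
countGe-sorted a {x ∷ xs} zero sorted refl a≤e =
  ≤-reflexive (trans (cong length (sym (filter-all (a ≤?_) (Linked⇒All ≤-trans a≤e sorted))))
                     (sym (+-identityʳ _)))
countGe-sorted a {x ∷ xs} (suc q) sorted eq a≤e = begin
  suc (length xs)            ≤⟨ s≤s (countGe-sorted a q (tail sorted) eq a≤e) ⟩
  suc (countGe a xs + q)     ≡⟨ +-suc _ q ⟨
  countGe a xs + suc q       ≤⟨ +-monoˡ-≤ (suc q) (countGe-∷ a x xs) ⟩
  countGe a (x ∷ xs) + suc q ∎
  where open ≤-Reasoning

Dominated : List ℕ → List ℕ → Set
Dominated S C' =
  ∀ r s e → r < length C' → nth (reverse S) r ≡ just s → nth (sort C') r ≡ just e → s ≤ e

EnoughLargeEntries : List ℕ → List ℕ → Set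
EnoughLargeEntries C' []       = ⊤
EnoughLargeEntries C' (a ∷ as) = (length C' ≤ countGe a C' + length as) × EnoughLargeEntries C' as

-- In increasing order a is the entry of S at index |as|, which is dominated by the entry of
-- sort C' at that index; all later entries of sort C' are at least as large.
dominated⇒enoughLargeEntries : ∀ C' S → Dominated S C' → EnoughLargeEntries C' S
dominated⇒enoughLargeEntries C' []       _   = tt
dominated⇒enoughLargeEntries C' (a ∷ as) dom =
  room , dominated⇒enoughLargeEntries C' as (λ r s e r< eq → dom r s e r< (nth-reverse-∷ˡ a as r eq))
  where
  room : length C' ≤ countGe a C' + length as
  room with length as <? length C'
  ... | no  as≮C' = ≤-trans (≮⇒≥ as≮C') (m≤n+m _ _)
  ... | yes as<C'
    with <-length⇒nth (sort C') (length as) (subst (length as <_) (sym (↭-length (sort-↭ C'))) as<C')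
  ...   | e , eq =
    subst₂ (λ m n → m ≤ n + length as) (↭-length (sort-↭ C')) (countGe-↭ a (sort-↭ C'))
      (countGe-sorted a (length as) (sort-↗ C') eq
        (dom (length as) a e as<C' (nth-reverse-∷-length a as) eq))

Filled : List (Maybe ℕ) → ℕ → ℕ → Set
Filled L i z = nth L i ≡ just (just z)

Empty : List (Maybe ℕ) → ℕ → Set
Empty L i = nth L i ≡ just nothing

countFilled : List (Maybe ℕ) → ℕ
countFilled []            = 0
countFilled (nothing ∷ L) = countFilled L
countFilled (just _ ∷ L)  = suc (countFilled L)

countFilled-≤-length : ∀ L → countFilled L ≤ length L
countFilled-≤-length []            = z≤n
countFilled-≤-length (nothing ∷ L) = m≤n⇒m≤1+n (countFilled-≤-length L)
countFilled-≤-length (just _ ∷ L)  = s≤s (countFilled-≤-length L)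

countFilled-replicate-nothing : ∀ n → countFilled (replicate n nothing) ≡ 0
countFilled-replicate-nothing zero    = refl
countFilled-replicate-nothing (suc n) = countFilled-replicate-nothing n

replicate-nothing-unfilled : ∀ n i {z} → ¬ Filled (replicate n nothing) i z
replicate-nothing-unfilled (suc n) zero    ()
replicate-nothing-unfilled (suc n) (suc i) f = replicate-nothing-unfilled n i f

countFilled-take-last : ∀ n L {z} → length L ≡ suc n → Filled L n z →
  countFilled L ≡ suc (countFilled (take n L))
countFilled-take-last zero    (just _ ∷ [])  _  _ = refl
countFilled-take-last (suc n) (nothing ∷ L) eq f = countFilled-take-last n L (suc-injective eq) f
countFilled-take-last (suc n) (just _ ∷ L)  eq f = cong suc (countFilled-take-last n L (suc-injective eq) f)

isEmptyRow⇒Empty : ∀ L i → isEmptyRow L i ≡ true → Empty L i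
isEmptyRow⇒Empty L i eq with nth L i
... | just nothing = refl

Empty⇒isEmptyRow : ∀ L i → Empty L i → isEmptyRow L i ≡ true
Empty⇒isEmptyRow L i e rewrite e = refl

isEmptyRow≡false⇒¬Empty : ∀ L i → isEmptyRow L i ≡ false → ¬ Empty L i
isEmptyRow≡false⇒¬Empty L i eq e with () ← trans (sym (Empty⇒isEmptyRow L i e)) eq

isEmptyRow≡false⇒Filled : ∀ L i → i < length L → isEmptyRow L i ≡ false → ∃ (Filled L i)
isEmptyRow≡false⇒Filled L i i<L eq with <-length⇒nth L i i<L
... | just z  , f = z , f
... | nothing , e = ⊥-elim (isEmptyRow≡false⇒¬Empty L i eq e)

record Placed (a r : ℕ) (L L' : List (Maybe ℕ)) : Set where
  field
    filled          : Filled L' r a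
    elsewhere       : ∀ {i} → i ≢ r → nth L' i ≡ nth L i
    length-≡        : length L' ≡ length L
    countFilled-suc : countFilled L' ≡ suc (countFilled L)

place-empty : ∀ a r L → Empty L r → ∃ λ L' → place a r L ≡ just L' × Placed a r L L'
place-empty a zero (nothing ∷ L) refl = just a ∷ L , refl , record
  { filled          = refl
  ; elsewhere       = λ { {zero} 0≢0 → ⊥-elim (0≢0 refl) ; {suc i} _ → refl }
  ; length-≡        = refl
  ; countFilled-suc = refl
  }
place-empty a (suc r) (m ∷ L) e with place-empty a r L e
... | L' , eq , placed rewrite eq = m ∷ L' , refl , record
  { filled          = filled
  ; elsewhere       = λ { {zero} _ → refl ; {suc i} i≢r → elsewhere (i≢r ∘ cong suc) }
  ; length-≡        = cong suc length-≡
  ; countFilled-suc = countFilled-∷ m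
  }
  where
  open Placed placed
  countFilled-∷ : ∀ m → countFilled (m ∷ L') ≡ suc (countFilled (m ∷ L))
  countFilled-∷ nothing  = countFilled-suc
  countFilled-∷ (just _) = cong suc countFilled-suc

module _ (C' : List ℕ) (L : List (Maybe ℕ)) where

  Candidate : ℕ → ℕ → Set
  Candidate v j = Empty L j × nth C' j ≡ just v

  BestAtLeast : ℕ → Maybe (ℕ × ℕ) → Set
  BestAtLeast w best = ∃₂ λ v j → best ≡ just (v , j) × w ≤ v

  -- D is the part of C' from row i on, still to be scanned.
  record EmptyRowAtLeast (w : ℕ) (D : List ℕ) (i : ℕ) : Set where
    constructor emptyRowAtLeast
    field
      offset   : ℕ
      entry    : ℕ
      at       : nth D offset ≡ just entry
      empty    : Empty L (i + offset)
      w≤entry  : w ≤ entry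

  AttainsAtLeast : ℕ → Maybe (ℕ × ℕ) → List ℕ → ℕ → Set
  AttainsAtLeast w best D i = BestAtLeast w best ⊎ EmptyRowAtLeast w D i

  attainsAtLeast-∷ : ∀ {w best best' e D i} →
    (BestAtLeast w best → BestAtLeast w best') → (Empty L i → w ≤ e → BestAtLeast w best') →
    AttainsAtLeast w best (e ∷ D) i → AttainsAtLeast w best' D (suc i)
  attainsAtLeast-∷ fromBest fromHead (inj₁ b) = inj₁ (fromBest b)
  attainsAtLeast-∷ {i = i} fromBest fromHead (inj₂ (emptyRowAtLeast zero y refl em w≤y)) =
    inj₁ (fromHead (subst (Empty L) (+-identityʳ i) em) w≤y)
  attainsAtLeast-∷ {i = i} fromBest fromHead (inj₂ (emptyRowAtLeast (suc k) y eq em w≤y)) =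
    inj₂ (emptyRowAtLeast k y eq (subst (Empty L) (+-suc i k) em) w≤y)

  Suffix : ℕ → List ℕ → Set
  Suffix i D = ∀ k → nth C' (i + k) ≡ nth D k

  suffix-∷ : ∀ i {e D} → Suffix i (e ∷ D) → Suffix (suc i) D
  suffix-∷ i suffix k = trans (cong (nth C') (sym (+-suc i k))) (suffix (suc k))

  head-candidate : ∀ i {e D} → isEmptyRow L i ≡ true → Suffix i (e ∷ D) →
    ∀ {v j} → just (e , i) ≡ just (v , j) → Candidate v j
  head-candidate i rowᵢ suffix refl =
    isEmptyRow⇒Empty L i rowᵢ , trans (cong (nth C') (sym (+-identityʳ i))) (suffix 0)

  largestEmptyRowFrom-≥ : ∀ D i best w → Suffix i D →
    (∀ {v j} → best ≡ just (v , j) → Candidate v j) → AttainsAtLeast w best D i →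
    ∃₂ λ r v → largestEmptyRowFrom D L i best ≡ just r × Candidate v r × w ≤ v
  largestEmptyRowFrom-≥ [] i _ w _ cand (inj₁ (v , j , refl , w≤v)) = j , v , refl , cand refl , w≤v
  largestEmptyRowFrom-≥ (e ∷ D) i best w suffix cand attains with isEmptyRow L i in rowᵢ
  ... | false =
    largestEmptyRowFrom-≥ D (suc i) best w (suffix-∷ i suffix) cand
    (attainsAtLeast-∷ id (λ em → ⊥-elim (isEmptyRow≡false⇒¬Empty L i rowᵢ em)) attains)
  ... | true with best
  ...   | nothing =
    largestEmptyRowFrom-≥ D (suc i) (just (e , i)) w (suffix-∷ i suffix) (head-candidate i rowᵢ suffix)
    (attainsAtLeast-∷ (λ { (_ , _ , () , _) }) (λ _ w≤e → e , i , refl , w≤e) attains)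
  ...   | just (v , j) with v <ᵇ e in v<ᵇe
  ...     | true =
    largestEmptyRowFrom-≥ D (suc i) (just (e , i)) w (suffix-∷ i suffix) (head-candidate i rowᵢ suffix)
    (attainsAtLeast-∷ (λ { (_ , _ , refl , w≤v) → e , i , refl , <⇒≤ (≤-<-trans w≤v v<e) })
                      (λ _ w≤e → e , i , refl , w≤e) attains)
    where v<e = <ᵇ⇒< v e (subst T (sym v<ᵇe) tt)
  ...     | false =
    largestEmptyRowFrom-≥ D (suc i) (just (v , j)) w (suffix-∷ i suffix) cand
    (attainsAtLeast-∷ id (λ _ w≤e → v , j , refl , ≤-trans w≤e e≤v) attains)
    where e≤v = ≮⇒≥ (λ v<e → subst T v<ᵇe (<⇒<ᵇ v<e))

emptyRow-pigeonhole : ∀ t D L → length D ≤ length L →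
  (∀ {i z y} → Filled L i z → nth D i ≡ just y → t ≤ y) →
  countFilled (take (length D) L) < countGe t D →
  ∃₂ λ i y → Empty L i × nth D i ≡ just y × t ≤ y
emptyRow-pigeonhole t (e ∷ D) (m ∷ L) (s≤s D≤L) large fewer with t ≤? e | m
... | yes t≤e | nothing = 0 , e , refl , refl , t≤e
... | no  t≰e | just _  = ⊥-elim (t≰e (large {0} refl refl))
... | yes t≤e | just _
  with i , y , p ← emptyRow-pigeonhole t D L D≤L (λ {i} → large {suc i})
                     (s≤s⁻¹ (subst (_ <_) (countGe-accept D t≤e) fewer))
  = suc i , y , p
... | no  t≰e | nothing
  with i , y , p ← emptyRow-pigeonhole t D L D≤L (λ {i} → large {suc i})
                     (subst (_ <_) (countGe-reject D t≰e) fewer)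
  = suc i , y , p

-- The HHL conditions for an entry z in row i of the left column; in row |C'| there is no right
-- cell and only z ∉ C' matters.
FitsRow : List ℕ → ℕ → ℕ → Set
FitsRow C' i z = nth C' i ≡ just z ⊎ (indexOf z C' ≡ nothing × (∀ {y} → nth C' i ≡ just y → z < y))

-- L is the partial hat column after the elements of S preceding rest have been placed.
record Invariant (c : ℕ) (C' : List ℕ) (L : List (Maybe ℕ)) (rest : List ℕ) : Set where
  field
    length≡     : length L ≡ c
    filled+rest : countFilled L + length rest ≡ c
    aboveRest   : ∀ {i z} → Filled L i z → All (_< z) rest
    distinct    : ∀ {i j z} → Filled L i z → Filled L j z → i ≡ j
    fits        : ∀ {i z} → Filled L i z → FitsRow C' i z

next<filled : ∀ {c C' L a as i z} → Invariant c C' L (a ∷ as) → Filled L i z → a < z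
next<filled inv f with a<z ∷ _ ← Invariant.aboveRest inv f = a<z

initial-invariant : ∀ C' S → Invariant (length S) C' (replicate (length S) nothing) S
initial-invariant C' S = record
  { length≡     = length-replicate (length S)
  ; filled+rest = cong (_+ length S) (countFilled-replicate-nothing (length S))
  ; aboveRest   = λ {i} f → ⊥-elim (replicate-nothing-unfilled (length S) i f)
  ; distinct    = λ {i} f → ⊥-elim (replicate-nothing-unfilled (length S) i f)
  ; fits        = λ {i} f → ⊥-elim (replicate-nothing-unfilled (length S) i f)
  }

place-invariant : ∀ {c C' L a as r} → Invariant c C' L (a ∷ as) → All (_< a) as →
  Empty L r → FitsRow C' r a → ∃ λ L' → place a r L ≡ just L' × Invariant c C' L' as
place-invariant {c} {C'} {L} {a} {as} {r} inv as<a empty fitsₐ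
  with L' , eq , placed ← place-empty a r L empty = L' , eq , record
  { length≡     = trans length-≡ length≡
  ; filled+rest = trans (cong (_+ length as) countFilled-suc)
                        (trans (sym (+-suc (countFilled L) (length as))) filled+rest)
  ; aboveRest   = aboveRest′
  ; distinct    = distinct′
  ; fits        = fits′
  }
  where
  open Invariant inv
  open Placed placed
  at-r : ∀ {z} → Filled L' r z → a ≡ z
  at-r f = just-injective (just-injective (trans (sym filled) f))
  old : ∀ {i z} → i ≢ r → Filled L' i z → Filled L i z
  old i≢r f = trans (sym (elsewhere i≢r)) f
  aboveRest′ : ∀ {i z} → Filled L' i z → All (_< z) as
  aboveRest′ {i} f with i ≟ r
  ... | yes refl = subst (λ z → All (_< z) as) (at-r f) as<a
  ... | no  i≢r  with _ ∷ as<z ← aboveRest (old i≢r f) = as<z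
  distinct′ : ∀ {i j z} → Filled L' i z → Filled L' j z → i ≡ j
  distinct′ {i} {j} fᵢ fⱼ with i ≟ r | j ≟ r
  ... | yes refl | yes refl = refl
  ... | yes refl | no  j≢r  = ⊥-elim (<-irrefl (at-r fᵢ) (next<filled inv (old j≢r fⱼ)))
  ... | no  i≢r  | yes refl = ⊥-elim (<-irrefl (at-r fⱼ) (next<filled inv (old i≢r fᵢ)))
  ... | no  i≢r  | no  j≢r  = distinct (old i≢r fᵢ) (old j≢r fⱼ)
  fits′ : ∀ {i z} → Filled L' i z → FitsRow C' i z
  fits′ {i} f with i ≟ r
  ... | yes refl = subst (FitsRow C' i) (at-r f) fitsₐ
  ... | no  i≢r  = fits (old i≢r f)

entry-row-empty : ∀ {c C' L a as r} → Invariant c C' L (a ∷ as) →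
  nth C' r ≡ just a → r < length L → Empty L r
entry-row-empty {L = L} {r = r} inv eq r<L with <-length⇒nth L r r<L
... | nothing , empty = empty
... | just z  , f with Invariant.fits inv f
...   | inj₁ eq′      = ⊥-elim (<-irrefl (just-injective (trans (sym eq) eq′)) (next<filled inv f))
...   | inj₂ (_ , z<) = ⊥-elim (<-asym (z< eq) (next<filled inv f))

next<right-of-filled : ∀ {c C' L a as i z y} → Invariant c C' L (a ∷ as) →
  Filled L i z → nth C' i ≡ just y → a < y
next<right-of-filled inv f eq with Invariant.fits inv f
... | inj₁ eq′      = subst (_ <_) (just-injective (trans (sym eq′) eq)) (next<filled inv f)
... | inj₂ (_ , z<) = <-trans (next<filled inv f) (z< eq)

m+1+n≡o⇒o≤p+n⇒m<p : ∀ {m n o p} → m + suc n ≡ o → o ≤ p + n → m < p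
m+1+n≡o⇒o≤p+n⇒m<p {m} {n} {o} {p} eq o≤p+n =
  +-cancelʳ-≤ n (suc m) p (subst (_≤ p + n) (trans (sym eq) (+-suc m n)) o≤p+n)

largestEmptyRow-invariant : ∀ {c C' L a as} → Invariant c C' L (a ∷ as) → All (_< a) as →
  indexOf a C' ≡ nothing → length C' ≤ length L →
  countFilled (take (length C') L) + suc (length as) ≡ length C' → length C' ≤ countGe a C' + length as →
  ∃ λ L' → (largestEmptyRow C' L >>= λ r → place a r L) ≡ just L' × Invariant c C' L' as
largestEmptyRow-invariant {c} {C'} {L} {a} inv as<a a∉C' C'≤L filled+rest enough
  with i , y , emptyᵢ , eqᵢ , a≤y ←
         emptyRow-pigeonhole a C' L C'≤L (λ f eq → <⇒≤ (next<right-of-filled inv f eq))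
           (m+1+n≡o⇒o≤p+n⇒m<p filled+rest enough)
  with r , v , eqʳ , (emptyʳ , eqᵛ) , a≤v ←
         largestEmptyRowFrom-≥ C' L C' 0 nothing a (λ _ → refl) (λ ())
           (inj₂ (emptyRowAtLeast i y eqᵢ emptyᵢ a≤y))
  rewrite eqʳ =
    place-invariant inv as<a emptyʳ
      (inj₂ (a∉C' , λ eq → subst (a <_) (just-injective (trans (sym eqᵛ) eq)) a<v))
  where
  a<v = ≤∧≢⇒< a≤v (λ { refl → indexOf-nothing a C' r a∉C' eqᵛ })

filledAmong-length : ∀ {c C' L rest} → Invariant c C' L rest → c ≡ length C' →
  countFilled (take (length C') L) + length rest ≡ length C'
filledAmong-length {L = L} {rest} inv c≡C' =
  trans (cong (λ l → countFilled l + length rest) (take-all _ L (≤-reflexive (trans length≡ c≡C'))))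
        (trans filled+rest c≡C')
  where open Invariant inv

filledAmong-suc-length : ∀ {c C' L rest z} → Invariant c C' L rest → c ≡ suc (length C') →
  Filled L (length C') z → suc (countFilled (take (length C') L) + length rest) ≡ suc (length C')
filledAmong-suc-length {L = L} {rest} inv c≡1+C' f =
  trans (cong (_+ length rest) (sym (countFilled-take-last _ L (trans length≡ c≡1+C') f)))
        (trans filled+rest c≡1+C')
  where open Invariant inv

hatStep-invariant : ∀ {c C' L a as} → c ≡ length C' ⊎ c ≡ suc (length C') →
  Invariant c C' L (a ∷ as) → All (_< a) as → length C' ≤ countGe a C' + length as →
  ∃ λ L' → hatStep c C' L a ≡ just L' × Invariant c C' L' as
hatStep-invariant {c} {C'} {L} {a} {as} c≡ inv as<a enough with indexOf a C' in a∈?C'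
... | just r = place-invariant inv as<a (entry-row-empty inv eqʳ r<L) (inj₁ eqʳ)
  where
  eqʳ = indexOf-just a C' a∈?C'
  r<L = ≤-trans (nth-<-length C' r eqʳ) (subst (length C' ≤_) (sym (Invariant.length≡ inv))
          ([ ≤-reflexive ∘ sym , (λ { refl → n≤1+n _ }) ]′ c≡))
... | nothing with c ≟ suc (length C') | isEmptyRow L (length C') in rowᶜ′
...   | yes c≡1+C' | true =
  place-invariant inv as<a (isEmptyRow⇒Empty L (length C') rowᶜ′)
    (inj₂ (a∈?C' , λ eq → contradiction (trans (sym (nth-length C')) eq) λ ()))
...   | yes c≡1+C' | false
  with z , f ← isEmptyRow≡false⇒Filled L (length C')
                 (subst (length C' <_) (sym (trans (Invariant.length≡ inv) c≡1+C')) ≤-refl) rowᶜ′ =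
  largestEmptyRow-invariant inv as<a a∈?C'
    (subst (length C' ≤_) (sym (trans (Invariant.length≡ inv) c≡1+C')) (n≤1+n _))
    (suc-injective (filledAmong-suc-length inv c≡1+C' f)) enough
...   | no c≢1+C' | _ =
  largestEmptyRow-invariant inv as<a a∈?C'
    (≤-reflexive (sym (trans (Invariant.length≡ inv) c≡C'))) (filledAmong-length inv c≡C') enough
  where c≡C' = [ id , ⊥-elim ∘ c≢1+C' ]′ c≡

hatSteps-invariant : ∀ {c C' L} S → c ≡ length C' ⊎ c ≡ suc (length C') →
  Invariant c C' L S → StrictlyDecreasing S → EnoughLargeEntries C' S →
  ∃ λ L' → hatSteps c C' (just L) S ≡ just L' × Invariant c C' L' []
hatSteps-invariant []       _  inv _                  _               = _ , refl , inv
hatSteps-invariant (a ∷ as) c≡ inv (as<a ∷ decreasing) (enough , enoughs)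
  with L′ , eq , inv′ ← hatStep-invariant c≡ inv as<a enough
  rewrite eq = hatSteps-invariant as c≡ inv′ decreasing enoughs

complete-all-filled : ∀ L → countFilled L ≡ length L →
  ∃ λ C → complete L ≡ just C × length C ≡ length L × (∀ {i x} → nth C i ≡ just x → Filled L i x)
complete-all-filled []            _  = [] , refl , refl , λ ()
complete-all-filled (nothing ∷ L) eq = ⊥-elim (<-irrefl eq (s≤s (countFilled-≤-length L)))
complete-all-filled (just y ∷ L)  eq with C , eqᶜ , length≡ , filled ← complete-all-filled L (suc-injective eq)
  rewrite eqᶜ = y ∷ C , refl , cong suc length≡ , λ { {zero} refl → refl ; {suc i} e → filled e }

invariant-[]⇒all-filled : ∀ {c C' L} → Invariant c C' L [] → countFilled L ≡ length L
invariant-[]⇒all-filled inv = trans (sym (+-identityʳ _)) (trans filled+rest (sym length≡))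
  where open Invariant inv

invariant⇒HHL : ∀ {c C' L C} → c ≡ length C' ⊎ c ≡ suc (length C') → Unique C' → Invariant c C' L [] →
  length C ≡ length L → (∀ {i x} → nth C i ≡ just x → Filled L i x) → HHL C C'
invariant⇒HHL {c} {C'} {C = C} c≡ uniqueC' inv C≡L filled = record
  { lengths   = subst (λ n → n ≡ length C' ⊎ n ≡ suc (length C')) (sym (trans C≡L length≡)) c≡
  ; distinctL = nth-injective⇒Unique (λ e₁ e₂ → distinct (filled e₁) (filled e₂))
  ; distinctR = uniqueC'
  ; rowsLeq   = rowsLeq
  ; noAttack  = noAttack
  }
  where
  open Invariant inv
  rowsLeq : ∀ r x y → r < length C' → nth C r ≡ just x → nth C' r ≡ just y → x ≤ y
  rowsLeq r x y _ eqˣ eqʸ with fits (filled eqˣ)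
  ... | inj₁ eq′      = ≤-reflexive (just-injective (trans (sym eq′) eqʸ))
  ... | inj₂ (_ , x<) = <⇒≤ (x< eqʸ)
  noAttack : ∀ r s x y → s < r → nth C r ≡ just x → nth C' s ≡ just y → x ≢ y
  noAttack r s x y s<r eqˣ eqʸ refl with fits (filled eqˣ)
  ... | inj₁ eq′       = <-irrefl (Unique⇒nth-injective uniqueC' eqʸ eq′) s<r
  ... | inj₂ (x∉C' , _) = indexOf-nothing x C' s x∉C' eqʸ

proposition4p1 : (C' S : List ℕ) →
    All (λ x → 1 ≤ x) C' → Unique C' →
    All (λ x → 1 ≤ x) S → StrictlyDecreasing S →
    (length S ≡ length C' ⊎ length S ≡ suc (length C')) →
    (∀ r s e → r < length C' → nth (reverse S) r ≡ just s → nth (sort C') r ≡ just e → s ≤ e) →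
    Σ (List ℕ) (λ Ĉ → (hat S C' ≡ just Ĉ) × HHL Ĉ C')
-- Positivity of the entries plays no role.
proposition4p1 C' S _ uniqueC' _ decreasing c≡ dominated
  with L , eqᴸ , inv ← hatSteps-invariant S c≡ (initial-invariant C' S) decreasing
                         (dominated⇒enoughLargeEntries C' S dominated)
  with Ĉ , eqᶜ , Ĉ≡L , filled ← complete-all-filled L (invariant-[]⇒all-filled inv)
  = Ĉ , hat≡ , invariant⇒HHL c≡ uniqueC' inv Ĉ≡L filled
  where
  hat≡ : hat S C' ≡ just Ĉ
  hat≡ rewrite eqᴸ = eqᶜ
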